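{- Let $T\subseteq\Lambda$ be a tiling and let $I=[p\ldots q]\subseteq[2\ldots n-1]$ be a nonempty interval contained in the basis $B(T)$. Then $T(ext(I))\subseteq T$, where $ext(I)=[p-1\ldots q+1]$ and $T(ext(I))$ is the set of all triples $ijk\in\Lambda$ with $p-1\le i<j<k\le q+1$.
   Context: Fix an integer $n\ge 2$, $[n]=\{1,\dots,n\}$, and let $\Lambda$ be the set of triples $ijk$ with $i<j<k$ in $[n]$. For a quadruple $i<j<k<l$, its stick is the ordered sequence $(ijk,ijl,ikl,jkl)$. A subset of $\Lambda$ is a tiling if for every quadruple $i<j<k<l$ its intersection with the stick, written as a 0/1 string along the stick order, is one of $0000,1000,1100,1110,1111,0111,0011,0001$ (these are the inversion sets of rhombus tilings of the zonogon $Z(n;2)$). The basis of a tiling $T$ is $B(T)=\{j\in[2\ldots n-1]: (j-1)\,j\,(j+1)\in T\}$; $[a\ldots b]$ denotes the integer interval $\{a,a+1,\dots,b\}$. -}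

module Defs where

open import Data.Nat using (ℕ; _≤_; _<_; _∸_; suc)
open import Data.Bool using (Bool; true; false)
open import Data.Product using (_×_)
open import Data.Sum using (_⊎_)
open import Relation.Binary.PropositionalEquality using (_≡_)

-- A subset of [n] choose 3 is given by its characteristic function
-- T i j k = true  iff  ijk ∈ T.
Triples : Set
Triples = ℕ → ℕ → ℕ → Bool

InΛ : ℕ → ℕ → ℕ → ℕ → Set
InΛ n i j k = 1 ≤ i × i < j × j < k × k ≤ n

SubsetΛ : ℕ → Triples → Set
SubsetΛ n T = ∀ i j k → T i j k ≡ true → InΛ n i j k

data Allowed : Bool → Bool → Bool → Bool → Set where
  p0000 : Allowed false false false false
  p1000 : Allowed true  false false false
  p1100 : Allowed true  true  false false
  p1110 : Allowed true  true  true  false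
  p1111 : Allowed true  true  true  true
  p0111 : Allowed false true  true  true
  p0011 : Allowed false false true  true
  p0001 : Allowed false false false true

IsTiling : ℕ → Triples → Set
IsTiling n T =
  SubsetΛ n T ×
  (∀ i j k l → 1 ≤ i → i < j → j < k → k < l → l ≤ n →
     Allowed (T i j k) (T i j l) (T i k l) (T j k l))

InBasis : ℕ → Triples → ℕ → Set
InBasis n T j = 2 ≤ j × suc j ≤ n × T (j ∸ 1) j (suc j) ≡ true

-- Induction on the width k − i of a triple ijk inside [p−1 … q+1]. Width 2 is
-- a basis triple (i)(i+1)(i+2). Otherwise the triple is an inner element of a
-- stick whose two ends are narrower, hence in T: for j > i+1 it is the third
-- entry of the stick of (i, i+1, j, k), for j = i+1 the second entry of the
-- stick of (i, i+1, i+2, k). Every allowed pattern with both ends 1 is 1111.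
module Submission where

open import Defs
open import Data.Nat using (ℕ; _≤_; _<_; _∸_; suc; zero; _+_; s≤s; z≤n)
open import Data.Nat.Properties
  using (≤-refl; ≤-trans; ≤-pred; <⇒≤; <-trans; <-irrefl; n≤1+n; m≤m+n; +-suc; m≤n⇒m<n∨m≡n)
open import Data.Bool using (Bool; true)
open import Data.Product using (_×_; _,_; proj₁; proj₂)
open import Data.Sum using (_⊎_; inj₁; inj₂)
open import Data.Empty using (⊥-elim)
open import Relation.Binary.PropositionalEquality using (_≡_; refl; sym; subst)

Allowed-ends⇒inner : ∀ {w x y z : Bool} → Allowed w x y z →
  w ≡ true → z ≡ true → x ≡ true × y ≡ true
Allowed-ends⇒inner p1111 refl refl = refl , refl

module IntervalFilling
  (T : Triples) (a b : ℕ)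
  (sticks : ∀ i j k l → a ≤ i → i < j → j < k → k < l → l ≤ b →
     Allowed (T i j k) (T i j l) (T i k l) (T j k l))
  (consecutive : ∀ i → a ≤ i → suc (suc i) ≤ b → T i (suc i) (suc (suc i)) ≡ true)
  where

  filled-upToWidth : ∀ w i j k → k ≤ w + i →
    a ≤ i → i < j → j < k → k ≤ b → T i j k ≡ true
  filled-upToWidth zero i j k k≤i _ i<j j<k _ =
    ⊥-elim (<-irrefl refl (≤-trans (<-trans i<j j<k) k≤i))
  filled-upToWidth (suc w) i j k k≤w+i a≤i i<j j<k k≤b =
    byMiddle j (m≤n⇒m<n∨m≡n i<j) j<k
    where
    narrowerˡ : ∀ m → suc i < m → m < k → T i (suc i) m ≡ true
    narrowerˡ m i+1<m m<k = filled-upToWidth w i (suc i) m (≤-pred (≤-trans m<k k≤w+i))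
      a≤i ≤-refl i+1<m (≤-trans (<⇒≤ m<k) k≤b)

    narrowerʳ : ∀ m → suc i < m → m < k → T (suc i) m k ≡ true
    narrowerʳ m i+1<m m<k = filled-upToWidth w (suc i) m k (subst (k ≤_) (sym (+-suc w i)) k≤w+i)
      (≤-trans a≤i (n≤1+n i)) i+1<m m<k k≤b

    byLast : suc (suc i) < k ⊎ suc (suc i) ≡ k → T i (suc i) k ≡ true
    byLast (inj₁ i+2<k) = proj₁ (Allowed-ends⇒inner
      (sticks i (suc i) (suc (suc i)) k a≤i ≤-refl ≤-refl i+2<k k≤b)
      (narrowerˡ (suc (suc i)) ≤-refl i+2<k)
      (narrowerʳ (suc (suc i)) ≤-refl i+2<k))
    byLast (inj₂ i+2≡k) = subst (λ m → T i (suc i) m ≡ true) i+2≡k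
      (consecutive i a≤i (subst (_≤ b) (sym i+2≡k) k≤b))

    byMiddle : ∀ m → suc i < m ⊎ suc i ≡ m → m < k → T i m k ≡ true
    byMiddle m (inj₁ i+1<m) m<k = proj₂ (Allowed-ends⇒inner
      (sticks i (suc i) m k a≤i ≤-refl i+1<m m<k k≤b)
      (narrowerˡ m i+1<m m<k)
      (narrowerʳ m i+1<m m<k))
    byMiddle _ (inj₂ refl) i+1<k = byLast (m≤n⇒m<n∨m≡n i+1<k)

  filled : ∀ i j k → a ≤ i → i < j → j < k → k ≤ b → T i j k ≡ true
  filled i j k = filled-upToWidth k i j k (m≤m+n k i)

lemma5 : (n : ℕ) → 2 ≤ n → (T : Triples) → IsTiling n T →
    (p q : ℕ) → 2 ≤ p → p ≤ q → suc q ≤ n →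
    (∀ j → p ≤ j → j ≤ q → InBasis n T j) →
    ∀ i j k → p ∸ 1 ≤ i → i < j → j < k → k ≤ suc q → T i j k ≡ true
lemma5 n _ T (_ , tiling) (suc (suc p′)) q (s≤s (s≤s z≤n)) _ q<n basis =
  IntervalFilling.filled T (suc p′) (suc q) sticks consecutive
  where
  sticks : ∀ i j k l → suc p′ ≤ i → i < j → j < k → k < l → l ≤ suc q →
    Allowed (T i j k) (T i j l) (T i k l) (T j k l)
  sticks i j k l p≤i i<j j<k k<l l≤q+1 =
    tiling i j k l (≤-trans (s≤s z≤n) p≤i) i<j j<k k<l (≤-trans l≤q+1 q<n)

  consecutive : ∀ i → suc p′ ≤ i → suc (suc i) ≤ suc q →
    T i (suc i) (suc (suc i)) ≡ true
  consecutive i p≤i i+2≤q+1 = proj₂ (proj₂ (basis (suc i) (s≤s p≤i) (≤-pred i+2≤q+1)))
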